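{- Let $p=p[1\ldots m]$ and $t=t[1\ldots n]$ be sequences of pairwise distinct integers, let $1\le j\le n-m+1$ and $x=t[j\ldots j+m-1]$. Let $\ell=\mathrm{lcp}(\overrightarrow{PD}_p,\overrightarrow{PD}_x)$ and $r=\mathrm{lcs}(\overleftarrow{PD}_p,\overleftarrow{PD}_x)$. If $\ell+r\ge m-1$, then $p\overset{\textsc{MIS}}{\approx}_{CT} x$.
   Context: The Cartesian tree $C(x)$ of a sequence $x$ has as root the position $g$ of its minimum, left subtree $C(x[1\ldots g-1])$ and right subtree the Cartesian tree of the part after $g$; $u\approx_{CT} v$ means $C(u)=C(v)$ (empty sequences match). $\overrightarrow{PD}_x[h]=h-\max\{k<h: x[k]<x[h]\}$ if such $k$ exists and $0$ otherwise; $\overleftarrow{PD}_x[h]=\min\{k>h: x[k]<x[h]\}-h$ if such $k$ exists and $0$ otherwise. $\mathrm{lcp}(u,v)$ and $\mathrm{lcs}(u,v)$ are the lengths of the longest common prefix and longest common suffix of sequences $u,v$. For $x,y$ of length $m$, $x\overset{\textsc{MIS}}{\approx}_{CT} y$ means there exists $h\in\{1,\ldots,m\}$ with $x[1\ldots h-1]\approx_{CT} y[1\ldots h-1]$ and $x[h+1\ldots m]\approx_{CT} y[h+1\ldots m]$. -}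

module Defs where

open import Data.Nat using (ℕ; zero; suc; _∸_)
open import Data.Integer using (ℤ; _<?_; _⊓_)
open import Data.Integer.Properties using () renaming (_≟_ to _≟ℤ_)
open import Data.List using (List; []; _∷_; length; take; drop; reverse; foldr)
open import Data.Product using (∃; _×_)
open import Relation.Nullary using (yes; no)
open import Relation.Binary.PropositionalEquality using (_≡_)
open import Data.Nat using (_≤_)

-- Sequences are lists of integers, 1-based in the paper.

-- x[i … j] (1-based, inclusive): the sequence of length m starting at position j
slice : List ℤ → ℕ → ℕ → List ℤ
slice t j m = take m (drop (j ∸ 1) t)

data CTree : Set where
  leaf : CTree
  node : CTree → ℕ → CTree → CTree

-- 0-based index of the first occurrence of v in xs (length xs if absent)
indexOf : ℤ → List ℤ → ℕ
indexOf v [] = zero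
indexOf v (a ∷ as) with a ≟ℤ v
... | yes _ = zero
... | no _  = suc (indexOf v as)

-- Cartesian tree with fuel; root labelled by the (1-based) position g
-- of the minimum, left subtree C(x[1…g-1]), right subtree C(x[g+1…]).
ctFuel : ℕ → List ℤ → CTree
ctFuel zero _ = leaf
ctFuel (suc f) [] = leaf
ctFuel (suc f) (a ∷ as) =
  let xs = a ∷ as
      i  = indexOf (foldr _⊓_ a as) xs
  in node (ctFuel f (take i xs)) (suc i) (ctFuel f (drop (suc i) xs))

-- The fuel length x suffices since both parts are strictly shorter.
C : List ℤ → CTree
C x = ctFuel (length x) x

_≈CT_ : List ℤ → List ℤ → Set
u ≈CT v = C u ≡ C v

firstLess : ℤ → List ℤ → ℕ
firstLess v [] = zero
firstLess v (a ∷ as) with a <? v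
... | yes _ = suc zero
... | no _ with firstLess v as
...   | zero  = zero
...   | suc k = suc (suc k)

-- acc is the reversed prefix seen so far
pdLeftAux : List ℤ → List ℤ → List ℕ
pdLeftAux acc [] = []
pdLeftAux acc (a ∷ as) = firstLess a acc ∷ pdLeftAux (a ∷ acc) as

-- PD→_x[h] = h - max{k<h : x[k] < x[h]} or 0
PDL : List ℤ → List ℕ
PDL x = pdLeftAux [] x

-- PD←_x[h] = min{k>h : x[k] < x[h]} - h or 0
PDR : List ℤ → List ℕ
PDR [] = []
PDR (a ∷ as) = firstLess a as ∷ PDR as

lcp : List ℕ → List ℕ → ℕ
lcp [] _ = zero
lcp (_ ∷ _) [] = zero
lcp (a ∷ as) (b ∷ bs) with a Data.Nat.≟ b
... | yes _ = suc (lcp as bs)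
... | no _  = zero

lcs : List ℕ → List ℕ → ℕ
lcs u v = lcp (reverse u) (reverse v)

_≈MIS_ : List ℤ → List ℤ → Set
x ≈MIS y = ∃ λ h → (1 ≤ h) × (h ≤ length x)
         × (take (h ∸ 1) x ≈CT take (h ∸ 1) y)
         × (drop h x ≈CT drop h y)

-- Either parent-distance array of a sequence of distinct integers determines its Cartesian
-- tree. The minimum sits at the last zero of PD→; the entries before it are PD→ of the prefix,
-- and those after it are PD→ of the suffix capped at the distance to the minimum, which can be
-- undone because uncapped distances are shorter. PD← is symmetric (first zero, prefix capped).
-- PD→ commutes with prefixes and PD← with suffixes, so the mismatch position h = min(ℓ + 1, m)
-- leaves a prefix inside the common prefix of the PD→ arrays and a suffix inside the common
-- suffix of the PD← arrays.
module Submission where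

open import Defs
open import Data.Nat using (ℕ; _+_; _∸_; _≤_)
open import Data.Integer using (ℤ)
open import Data.List using (List; length)
open import Data.List.Relation.Unary.Unique.Propositional using (Unique)

open import Data.Nat using (zero; suc; s≤s; z≤n; s≤s⁻¹; _⊓_; _≤?_; _≟_)
open import Data.Nat.Properties
  using (≤-refl; 1+n≰n; <⇒≤; ≰⇒>; +-comm; m≤n⇒m⊓n≡m; m+n≤o⇒m≤o∸n; m≤n+o⇒m∸n≤o; n∸n≡0)
open import Data.Integer using (_<_; _<?_) renaming (_≤_ to _≤ℤ_; _⊓_ to _⊓ℤ_)
open import Data.Integer.Properties using (<-asym; ≤∧≢⇒<; i⊓j≤i; i⊓j≤j; ⊓-sel)
  renaming (≤-refl to ≤ℤ-refl; ≤-trans to ≤ℤ-trans; _≟_ to _≟ℤ_)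
open import Data.List using ([]; _∷_; _++_; take; drop; reverse; reverseAcc; foldr)
open import Data.List.Properties
  using (∷-injectiveˡ; ∷-injectiveʳ; length-take; length-drop; length-reverse; reverse-++;
         reverse-injective; take++drop≡id; foldr-forcesᵇ; foldr-preservesʳ)
open import Data.List.Membership.Propositional using (_∈_)
open import Data.List.Membership.Propositional.Properties using (foldr-selective)
open import Data.List.Relation.Unary.All as All using (All; []; _∷_)
open import Data.List.Relation.Unary.All.Properties using (++⁻ʳ)
open import Data.List.Relation.Unary.Any as Any using (here; there)
open import Data.List.Relation.Unary.AllPairs using (_∷_)
import Data.List.Relation.Unary.Unique.Propositional.Properties as Unique
open import Data.Product using (∃; _×_; _,_; proj₁; proj₂)
open import Data.Sum using (inj₁; inj₂)
open import Function using (_∘_)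
open import Relation.Nullary using (yes; no; contradiction)
open import Relation.Binary.PropositionalEquality
open ≡-Reasoning

_orElse_ : ℕ → ℕ → ℕ
zero  orElse n = n
suc k orElse n = suc k

orElse-nonzero : ∀ k n → k orElse suc n ≢ 0
orElse-nonzero zero    n ()
orElse-nonzero (suc k) n ()

orElse-injective : ∀ {k k′ n} → k ≤ n → k′ ≤ n → k orElse suc n ≡ k′ orElse suc n → k ≡ k′
orElse-injective {zero}  {zero}       _   _    _  = refl
orElse-injective {zero}  {suc k′} {n} _   k′≤n eq = contradiction (subst (_≤ n) (sym eq) k′≤n) 1+n≰n
orElse-injective {suc k} {zero}   {n} k≤n _    eq = contradiction (subst (_≤ n) eq k≤n) 1+n≰n
orElse-injective {suc k} {suc k′}     _   _    eq = eq

firstLess-≤-length : ∀ a xs → firstLess a xs ≤ length xs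
firstLess-≤-length a []       = z≤n
firstLess-≤-length a (c ∷ xs) with c <? a
... | yes _ = s≤s z≤n
... | no  _ with firstLess a xs | firstLess-≤-length a xs
...   | zero  | _   = z≤n
...   | suc k | k<n = s≤s k<n

firstLess-above : ∀ {a} xs → All (a <_) xs → firstLess a xs ≡ 0
firstLess-above     []       []           = refl
firstLess-above {a} (c ∷ xs) (a<c ∷ a<xs) with c <? a
... | yes c<a = contradiction c<a (<-asym a<c)
... | no  _ rewrite firstLess-above xs a<xs = refl

firstLess-++-below : ∀ {a m} xs ys → m < a →
                     firstLess a (xs ++ m ∷ ys) ≡ firstLess a xs orElse suc (length xs)
firstLess-++-below {a} {m} [] ys m<a with m <? a
... | yes _   = refl
... | no  m≮a = contradiction m<a m≮a
firstLess-++-below {a} (c ∷ xs) ys m<a with c <? a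
... | yes _ = refl
... | no  _ rewrite firstLess-++-below xs ys m<a with firstLess a xs
...   | zero  = refl
...   | suc k = refl

-- Since m < a, the distance in xs ++ m ∷ ys is capped at the one to m, while distances
-- inside xs are at most length xs; hence the capped value determines the uncapped one.
firstLess-uncap : ∀ {a a′ m m′} xs xs′ ys ys′ → length xs ≡ length xs′ → m < a → m′ < a′ →
                  firstLess a (xs ++ m ∷ ys) ≡ firstLess a′ (xs′ ++ m′ ∷ ys′) →
                  firstLess a xs ≡ firstLess a′ xs′
firstLess-uncap {a} {a′} {m} {m′} xs xs′ ys ys′ |xs| m<a m′<a′ eq =
  orElse-injective (firstLess-≤-length a xs) (subst (_ ≤_) (sym |xs|) (firstLess-≤-length a′ xs′)) (begin
    firstLess a xs orElse suc (length xs)      ≡⟨ sym (firstLess-++-below xs ys m<a) ⟩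
    firstLess a (xs ++ m ∷ ys)                 ≡⟨ eq ⟩
    firstLess a′ (xs′ ++ m′ ∷ ys′)             ≡⟨ firstLess-++-below xs′ ys′ m′<a′ ⟩
    firstLess a′ xs′ orElse suc (length xs′)   ≡⟨ cong (λ n → firstLess a′ xs′ orElse suc n) (sym |xs|) ⟩
    firstLess a′ xs′ orElse suc (length xs)    ∎)

module _ {A : Set} {x : A} where

  split-at-first-occurrence : ∀ {xs ys zs ws} → All (_≢ x) xs → All (_≢ x) ys →
                              xs ++ x ∷ zs ≡ ys ++ x ∷ ws → xs ≡ ys × zs ≡ ws
  split-at-first-occurrence []           []           eq = refl , ∷-injectiveʳ eq
  split-at-first-occurrence []           (y≢x ∷ _)    eq = contradiction (sym (∷-injectiveˡ eq)) y≢x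
  split-at-first-occurrence (x′≢x ∷ _)   []           eq = contradiction (∷-injectiveˡ eq) x′≢x
  split-at-first-occurrence (_ ∷ xs≢x)   (_ ∷ ys≢x)   eq =
    let xs≡ys , zs≡ws = split-at-first-occurrence xs≢x ys≢x (∷-injectiveʳ eq)
    in cong₂ _∷_ (∷-injectiveˡ eq) xs≡ys , zs≡ws

  split-at-last-occurrence : ∀ xs ys {zs ws} → All (_≢ x) zs → All (_≢ x) ws →
                             xs ++ x ∷ zs ≡ ys ++ x ∷ ws → xs ≡ ys × zs ≡ ws
  split-at-last-occurrence []       []       _     _     eq = refl , ∷-injectiveʳ eq
  split-at-last-occurrence []       (_ ∷ ys) zs≢x  _     eq =
    contradiction refl (All.head (++⁻ʳ ys (subst (All (_≢ x)) (∷-injectiveʳ eq) zs≢x)))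
  split-at-last-occurrence (_ ∷ xs) []       _     ws≢x  eq =
    contradiction refl (All.head (++⁻ʳ xs (subst (All (_≢ x)) (sym (∷-injectiveʳ eq)) ws≢x)))
  split-at-last-occurrence (_ ∷ xs) (_ ∷ ys) zs≢x  ws≢x  eq =
    let xs≡ys , zs≡ws = split-at-last-occurrence xs ys zs≢x ws≢x (∷-injectiveʳ eq)
    in cong₂ _∷_ (∷-injectiveˡ eq) xs≡ys , zs≡ws

SplitsAtMinimum : (List ℤ → List ℕ) → Set
SplitsAtMinimum F = ∀ {v v′} P S P′ S′ →
  All (v <_) P → All (v <_) S → All (v′ <_) P′ → All (v′ <_) S′ →
  F (P ++ v ∷ S) ≡ F (P′ ++ v′ ∷ S′) → F P ≡ F P′ × F S ≡ F S′

All-reverseAcc⁺ : ∀ {P : ℤ → Set} {acc} xs → All P acc → All P xs → All P (reverseAcc acc xs)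
All-reverseAcc⁺ []       Pacc []         = Pacc
All-reverseAcc⁺ (x ∷ xs) Pacc (Px ∷ Pxs) = All-reverseAcc⁺ xs (Px ∷ Pacc) Pxs

pdLeftAux-++ : ∀ acc xs ys → pdLeftAux acc (xs ++ ys) ≡ pdLeftAux acc xs ++ pdLeftAux (reverseAcc acc xs) ys
pdLeftAux-++ acc []       ys = refl
pdLeftAux-++ acc (x ∷ xs) ys = cong (firstLess x acc ∷_) (pdLeftAux-++ (x ∷ acc) xs ys)

pdLeftAux-take : ∀ acc k xs → pdLeftAux acc (take k xs) ≡ take k (pdLeftAux acc xs)
pdLeftAux-take acc zero    xs       = refl
pdLeftAux-take acc (suc k) []       = refl
pdLeftAux-take acc (suc k) (x ∷ xs) = cong (firstLess x acc ∷_) (pdLeftAux-take (x ∷ acc) k xs)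

length-pdLeftAux : ∀ acc xs → length (pdLeftAux acc xs) ≡ length xs
length-pdLeftAux acc []       = refl
length-pdLeftAux acc (x ∷ xs) = cong suc (length-pdLeftAux (x ∷ acc) xs)

pdLeftAux-nonzero : ∀ acc {m} ys xs → All (m <_) xs → All (_≢ 0) (pdLeftAux (acc ++ m ∷ ys) xs)
pdLeftAux-nonzero acc ys []       []           = []
pdLeftAux-nonzero acc ys (x ∷ xs) (m<x ∷ m<xs) =
  (orElse-nonzero _ _ ∘ trans (sym (firstLess-++-below acc ys m<x))) ∷ pdLeftAux-nonzero (x ∷ acc) ys xs m<xs

pdLeftAux-uncap : ∀ acc acc′ {m m′} ys ys′ xs xs′ → length acc ≡ length acc′ →
                  All (m <_) xs → All (m′ <_) xs′ →
                  pdLeftAux (acc ++ m ∷ ys) xs ≡ pdLeftAux (acc′ ++ m′ ∷ ys′) xs′ →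
                  pdLeftAux acc xs ≡ pdLeftAux acc′ xs′
pdLeftAux-uncap acc acc′ ys ys′ []       []         _     _            _              _  = refl
pdLeftAux-uncap acc acc′ ys ys′ (x ∷ xs) (x′ ∷ xs′) |acc| (m<x ∷ m<xs) (m′<x′ ∷ m′<xs′) eq =
  cong₂ _∷_ (firstLess-uncap acc acc′ ys ys′ |acc| m<x m′<x′ (∷-injectiveˡ eq))
            (pdLeftAux-uncap (x ∷ acc) (x′ ∷ acc′) ys ys′ xs xs′ (cong suc |acc|) m<xs m′<xs′ (∷-injectiveʳ eq))

PDL-at-minimum : ∀ {v} P S → All (v <_) P →
                 PDL (P ++ v ∷ S) ≡ PDL P ++ 0 ∷ pdLeftAux (v ∷ reverse P) S
PDL-at-minimum {v} P S v<P = begin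
  PDL (P ++ v ∷ S)                         ≡⟨ pdLeftAux-++ [] P (v ∷ S) ⟩
  PDL P ++ firstLess v (reverse P) ∷ rest  ≡⟨ cong (λ k → PDL P ++ k ∷ rest) v-first ⟩
  PDL P ++ 0 ∷ rest                        ∎
  where
  rest : List ℕ
  rest = pdLeftAux (v ∷ reverse P) S
  v-first : firstLess v (reverse P) ≡ 0
  v-first = firstLess-above (reverse P) (All-reverseAcc⁺ P [] v<P)

PDL-splitsAtMinimum : SplitsAtMinimum PDL
PDL-splitsAtMinimum P S P′ S′ v<P v<S v′<P′ v′<S′ eq =
  let PDL-P , after-P = split-at-last-occurrence (PDL P) (PDL P′)
        (pdLeftAux-nonzero [] (reverse P) S v<S) (pdLeftAux-nonzero [] (reverse P′) S′ v′<S′)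
        (trans (sym (PDL-at-minimum P S v<P)) (trans eq (PDL-at-minimum P′ S′ v′<P′)))
  in PDL-P , pdLeftAux-uncap [] [] (reverse P) (reverse P′) S S′ refl v<S v′<S′ after-P

pdRightAux : List ℤ → List ℤ → List ℕ
pdRightAux []       ys = []
pdRightAux (x ∷ xs) ys = firstLess x (xs ++ ys) ∷ pdRightAux xs ys

PDR-++ : ∀ xs ys → PDR (xs ++ ys) ≡ pdRightAux xs ys ++ PDR ys
PDR-++ []       ys = refl
PDR-++ (x ∷ xs) ys = cong (firstLess x (xs ++ ys) ∷_) (PDR-++ xs ys)

PDR-drop : ∀ k xs → PDR (drop k xs) ≡ drop k (PDR xs)
PDR-drop zero    xs       = refl
PDR-drop (suc k) []       = refl
PDR-drop (suc k) (x ∷ xs) = PDR-drop k xs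

length-pdRightAux : ∀ xs ys → length (pdRightAux xs ys) ≡ length xs
length-pdRightAux []       ys = refl
length-pdRightAux (x ∷ xs) ys = cong suc (length-pdRightAux xs ys)

length-PDR : ∀ xs → length (PDR xs) ≡ length xs
length-PDR []       = refl
length-PDR (x ∷ xs) = cong suc (length-PDR xs)

pdRightAux-nonzero : ∀ {m} xs ys → All (m <_) xs → All (_≢ 0) (pdRightAux xs (m ∷ ys))
pdRightAux-nonzero []       ys []           = []
pdRightAux-nonzero (x ∷ xs) ys (m<x ∷ m<xs) =
  (orElse-nonzero _ _ ∘ trans (sym (firstLess-++-below xs ys m<x))) ∷ pdRightAux-nonzero xs ys m<xs

pdRightAux-uncap : ∀ {m m′} xs xs′ ys ys′ → All (m <_) xs → All (m′ <_) xs′ →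
                   pdRightAux xs (m ∷ ys) ≡ pdRightAux xs′ (m′ ∷ ys′) → PDR xs ≡ PDR xs′
pdRightAux-uncap []       []         ys ys′ _ _ _ = refl
pdRightAux-uncap (x ∷ xs) (x′ ∷ xs′) ys ys′ (m<x ∷ m<xs) (m′<x′ ∷ m′<xs′) eq =
  cong₂ _∷_ (firstLess-uncap xs xs′ ys ys′ |xs| m<x m′<x′ (∷-injectiveˡ eq))
            (pdRightAux-uncap xs xs′ ys ys′ m<xs m′<xs′ (∷-injectiveʳ eq))
  where
  |xs| : length xs ≡ length xs′
  |xs| = trans (sym (length-pdRightAux xs _)) (trans (cong length (∷-injectiveʳ eq)) (length-pdRightAux xs′ _))

PDR-at-minimum : ∀ {v} P S → All (v <_) S →
                 PDR (P ++ v ∷ S) ≡ pdRightAux P (v ∷ S) ++ 0 ∷ PDR S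
PDR-at-minimum {v} P S v<S = begin
  PDR (P ++ v ∷ S)                               ≡⟨ PDR-++ P (v ∷ S) ⟩
  pdRightAux P (v ∷ S) ++ firstLess v S ∷ PDR S  ≡⟨ cong (λ k → pdRightAux P (v ∷ S) ++ k ∷ PDR S) (firstLess-above S v<S) ⟩
  pdRightAux P (v ∷ S) ++ 0 ∷ PDR S              ∎

PDR-splitsAtMinimum : SplitsAtMinimum PDR
PDR-splitsAtMinimum P S P′ S′ v<P v<S v′<P′ v′<S′ eq =
  let before-S , PDR-S = split-at-first-occurrence
        (pdRightAux-nonzero P S v<P) (pdRightAux-nonzero P′ S′ v′<P′)
        (trans (sym (PDR-at-minimum P S v<S)) (trans eq (PDR-at-minimum P′ S′ v′<S′)))
  in pdRightAux-uncap P P′ S S′ v<P v′<P′ before-S , PDR-S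

record MinimumAt (v : ℤ) (xs : List ℤ) (i : ℕ) : Set where
  field
    decomposition : xs ≡ take i xs ++ v ∷ drop (suc i) xs
    length-prefix : length (take i xs) ≡ i
    prefix-above  : All (v <_) (take i xs)
    suffix-above  : All (v <_) (drop (suc i) xs)

indexOf-minimumAt : ∀ {v} xs → v ∈ xs → All (v ≤ℤ_) xs → Unique xs → MinimumAt v xs (indexOf v xs)
indexOf-minimumAt {v} (x ∷ xs) v∈ (v≤x ∷ v≤xs) (x∉xs ∷ unique-xs) with x ≟ℤ v
... | yes refl = record
  { decomposition = refl
  ; length-prefix = refl
  ; prefix-above  = []
  ; suffix-above  = All.zipWith (λ (v≤y , v≢y) → ≤∧≢⇒< v≤y v≢y) (v≤xs , x∉xs)
  }
... | no x≢v = record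
  { decomposition = cong (x ∷_) decomposition
  ; length-prefix = cong suc length-prefix
  ; prefix-above  = ≤∧≢⇒< v≤x (x≢v ∘ sym) ∷ prefix-above
  ; suffix-above  = suffix-above
  }
  where open MinimumAt (indexOf-minimumAt xs (Any.tail (x≢v ∘ sym) v∈) v≤xs unique-xs)

foldr-⊓-∈ : ∀ a xs → foldr _⊓ℤ_ a xs ∈ a ∷ xs
foldr-⊓-∈ a xs with foldr-selective ⊓-sel a xs
... | inj₁ min≡a   = here min≡a
... | inj₂ min∈xs  = there min∈xs

foldr-⊓-≤ : ∀ a xs → All (foldr _⊓ℤ_ a xs ≤ℤ_) (a ∷ xs)
foldr-⊓-≤ a xs =
  foldr-preservesʳ {P = _≤ℤ a} (λ x {y} y≤a → ≤ℤ-trans (i⊓j≤j x y) y≤a) ≤ℤ-refl xs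
  ∷ foldr-forcesᵇ (λ x y v≤x⊓y → ≤ℤ-trans v≤x⊓y (i⊓j≤i x y) , ≤ℤ-trans v≤x⊓y (i⊓j≤j x y)) a xs ≤ℤ-refl

foldr-⊓-minimumAt : ∀ a xs → Unique (a ∷ xs) →
                    MinimumAt (foldr _⊓ℤ_ a xs) (a ∷ xs) (indexOf (foldr _⊓ℤ_ a xs) (a ∷ xs))
foldr-⊓-minimumAt a xs = indexOf-minimumAt (a ∷ xs) (foldr-⊓-∈ a xs) (foldr-⊓-≤ a xs)

cong-node : ∀ {l l′ n n′ r r′} → l ≡ l′ → n ≡ n′ → r ≡ r′ → node l n r ≡ node l′ n′ r′
cong-node refl refl refl = refl

module _ (F : List ℤ → List ℕ) (length-F : ∀ xs → length (F xs) ≡ length xs)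
         (F-splits : SplitsAtMinimum F) where

  private
    length-cong : ∀ {u w} → F u ≡ F w → length u ≡ length w
    length-cong {u} {w} eq = trans (sym (length-F u)) (trans (cong length eq) (length-F w))

  ctFuel-cong : ∀ f {u w} → Unique u → Unique w → F u ≡ F w → ctFuel f u ≡ ctFuel f w
  ctFuel-cong zero    _ _ _ = refl
  ctFuel-cong (suc f) {[]}     {[]}     _ _ _  = refl
  ctFuel-cong (suc f) {[]}     {_ ∷ _}  _ _ eq = contradiction (length-cong eq) λ ()
  ctFuel-cong (suc f) {_ ∷ _}  {[]}     _ _ eq = contradiction (length-cong eq) λ ()
  ctFuel-cong (suc f) {a ∷ as} {b ∷ bs} unique-u unique-w eq =
    cong-node (ctFuel-cong f (Unique.take⁺ i unique-u) (Unique.take⁺ j unique-w) F-prefix)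
              (cong suc i≡j)
              (ctFuel-cong f (Unique.drop⁺ (suc i) unique-u) (Unique.drop⁺ (suc j) unique-w) F-suffix)
    where
    u w : List ℤ
    u = a ∷ as
    w = b ∷ bs
    i j : ℕ
    i = indexOf (foldr _⊓ℤ_ a as) u
    j = indexOf (foldr _⊓ℤ_ b bs) w
    module U = MinimumAt (foldr-⊓-minimumAt a as unique-u)
    module W = MinimumAt (foldr-⊓-minimumAt b bs unique-w)
    F-prefix-suffix : F (take i u) ≡ F (take j w) × F (drop (suc i) u) ≡ F (drop (suc j) w)
    F-prefix-suffix = F-splits _ _ _ _ U.prefix-above U.suffix-above W.prefix-above W.suffix-above
                        (trans (cong F (sym U.decomposition)) (trans eq (cong F W.decomposition)))
    F-prefix : F (take i u) ≡ F (take j w)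
    F-prefix = proj₁ F-prefix-suffix
    F-suffix : F (drop (suc i) u) ≡ F (drop (suc j) w)
    F-suffix = proj₂ F-prefix-suffix
    i≡j : i ≡ j
    i≡j = trans (sym U.length-prefix) (trans (length-cong F-prefix) W.length-prefix)

  F-≡⇒≈CT : ∀ {u w} → Unique u → Unique w → F u ≡ F w → u ≈CT w
  F-≡⇒≈CT {u} {w} unique-u unique-w eq =
    trans (ctFuel-cong (length u) unique-u unique-w eq) (cong (λ f → ctFuel f w) (length-cong eq))

take-lcp : ∀ k xs ys → k ≤ lcp xs ys → take k xs ≡ take k ys
take-lcp zero    xs       ys       _ = refl
take-lcp (suc k) (x ∷ xs) (y ∷ ys) k<lcp with x ≟ y
... | yes refl = cong (x ∷_) (take-lcp k xs ys (s≤s⁻¹ k<lcp))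

take-length-++ : ∀ (xs ys : List ℕ) → take (length xs) (xs ++ ys) ≡ xs
take-length-++ []       ys = refl
take-length-++ (x ∷ xs) ys = cong (x ∷_) (take-length-++ xs ys)

take-reverse : ∀ k (xs : List ℕ) → take (length xs ∸ k) (reverse xs) ≡ reverse (drop k xs)
take-reverse k xs = begin
  take (length xs ∸ k) (reverse xs)                                     ≡⟨ cong₂ take (sym |drop|) reverse-xs ⟩
  take (length (reverse (drop k xs))) (reverse (drop k xs) ++ reverse (take k xs)) ≡⟨ take-length-++ _ _ ⟩
  reverse (drop k xs)                                                   ∎
  where
  |drop| : length (reverse (drop k xs)) ≡ length xs ∸ k
  |drop| = trans (length-reverse (drop k xs)) (length-drop k xs)
  reverse-xs : reverse xs ≡ reverse (drop k xs) ++ reverse (take k xs)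
  reverse-xs = trans (cong reverse (sym (take++drop≡id k xs))) (reverse-++ (take k xs) (drop k xs))

drop-lcs : ∀ k xs ys → length xs ≡ length ys → length xs ∸ k ≤ lcs xs ys → drop k xs ≡ drop k ys
drop-lcs k xs ys |xs| k≤lcs = reverse-injective (begin
  reverse (drop k xs)                ≡⟨ take-reverse k xs ⟨
  take (length xs ∸ k) (reverse xs)  ≡⟨ take-lcp _ (reverse xs) (reverse ys) k≤lcs ⟩
  take (length xs ∸ k) (reverse ys)  ≡⟨ cong (λ n → take (n ∸ k) (reverse ys)) |xs| ⟩
  take (length ys ∸ k) (reverse ys)  ≡⟨ take-reverse k ys ⟩
  reverse (drop k ys)                ∎)

take-≈CT : ∀ k {u w} → Unique u → Unique w → k ≤ lcp (PDL u) (PDL w) → take k u ≈CT take k w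
take-≈CT k {u} {w} unique-u unique-w k≤lcp =
  F-≡⇒≈CT PDL (length-pdLeftAux []) PDL-splitsAtMinimum (Unique.take⁺ k unique-u) (Unique.take⁺ k unique-w) (begin
    PDL (take k u)        ≡⟨ pdLeftAux-take [] k u ⟩
    take k (PDL u)        ≡⟨ take-lcp k (PDL u) (PDL w) k≤lcp ⟩
    take k (PDL w)        ≡⟨ pdLeftAux-take [] k w ⟨
    PDL (take k w)        ∎)

drop-≈CT : ∀ k {u w} → Unique u → Unique w → length u ≡ length w →
           length u ∸ k ≤ lcs (PDR u) (PDR w) → drop k u ≈CT drop k w
drop-≈CT k {u} {w} unique-u unique-w |u| k≤lcs =
  F-≡⇒≈CT PDR length-PDR PDR-splitsAtMinimum (Unique.drop⁺ k unique-u) (Unique.drop⁺ k unique-w) (begin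
    PDR (drop k u)        ≡⟨ PDR-drop k u ⟩
    drop k (PDR u)        ≡⟨ drop-lcs k (PDR u) (PDR w) |PDR| (subst (λ n → n ∸ k ≤ lcs (PDR u) (PDR w)) (sym (length-PDR u)) k≤lcs) ⟩
    drop k (PDR w)        ≡⟨ PDR-drop k w ⟨
    PDR (drop k w)        ∎)
  where
  |PDR| : length (PDR u) ≡ length (PDR w)
  |PDR| = trans (length-PDR u) (trans |u| (sym (length-PDR w)))

mismatch-position : ∀ {m ℓ r} → 1 ≤ m → m ∸ 1 ≤ ℓ + r →
                    ∃ λ h → 1 ≤ h × h ≤ m × h ∸ 1 ≤ ℓ × m ∸ h ≤ r
mismatch-position {suc m} {ℓ} {r} _ m≤ℓ+r with ℓ ≤? m
... | yes ℓ≤m = suc ℓ , s≤s z≤n , s≤s ℓ≤m , ≤-refl , m≤n+o⇒m∸n≤o m ℓ m≤ℓ+r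
... | no  ℓ≰m = suc m , s≤s z≤n , ≤-refl , <⇒≤ (≰⇒> ℓ≰m) , subst (_≤ r) (sym (n∸n≡0 m)) z≤n

length-slice : ∀ t j m → 1 ≤ j → j + m ≤ length t + 1 → length (slice t j m) ≡ m
length-slice t (suc j) m _ j+m≤ = begin
  length (take m (drop j t))  ≡⟨ length-take m (drop j t) ⟩
  m ⊓ length (drop j t)       ≡⟨ cong (m ⊓_) (length-drop j t) ⟩
  m ⊓ (length t ∸ j)          ≡⟨ m≤n⇒m⊓n≡m (m+n≤o⇒m≤o∸n m m+j≤) ⟩
  m                           ∎
  where
  m+j≤ : m + j ≤ length t
  m+j≤ = subst (_≤ length t) (+-comm j m) (s≤s⁻¹ (subst (suc j + m ≤_) (+-comm (length t) 1) j+m≤))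

lemma21 : (p t : List ℤ) (j : ℕ) →
    Unique p → Unique t →
    1 ≤ length p →
    1 ≤ j → j + length p ≤ length t + 1 →
    (length p ∸ 1 ≤ lcp (PDL p) (PDL (slice t j (length p)))
                    + lcs (PDR p) (PDR (slice t j (length p)))) →
    p ≈MIS slice t j (length p)
lemma21 p t j unique-p unique-t 1≤m 1≤j j+m≤ ℓ+r≥m-1 =
  let h , 1≤h , h≤m , h-1≤ℓ , m-h≤r = mismatch-position 1≤m ℓ+r≥m-1
  in h , 1≤h , h≤m
       , take-≈CT (h ∸ 1) unique-p unique-x h-1≤ℓ
       , drop-≈CT h unique-p unique-x (sym (length-slice t j m 1≤j j+m≤)) m-h≤r
  where
  m = length p
  unique-x : Unique (slice t j m)
  unique-x = Unique.take⁺ m (Unique.drop⁺ (j ∸ 1) unique-t)
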